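{- For every $n\ge 0$, the statistics $f(P)=$ "number of occurrences of the subword $DDD$ in $P$" and $g(P)=$ "number of occurrences of a subword of the form $DU^tDU$ with $t\ge 1$ in $P$" are equidistributed on the set of Dyck paths of semilength $n$, i.e. $\sum_P x^{f(P)}=\sum_P x^{g(P)}$, the sums ranging over all Dyck paths $P$ of semilength $n$.
   Context: A Dyck path of semilength $n$ is a word over $\{U,D\}$ with $n$ letters $U$ and $n$ letters $D$ such that every prefix has at least as many $U$'s as $D$'s (equivalently a lattice path from $(0,0)$ to $(2n,0)$ with steps $U=(1,1)$, $D=(1,-1)$ never going below the $x$-axis). A subword is a factor of consecutive letters; an occurrence of $DDD$ is a position where three consecutive letters are $DDD$, and an occurrence of $DU^tDU$ ($t\ge1$) is a position at which a factor $D\,U^t\,D\,U$ for some $t\ge 1$ begins. -}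

module Defs where

open import Data.Nat using (ℕ; zero; suc; _+_; _*_; _∸_; _≤ᵇ_; _≡ᵇ_)
open import Data.Bool using (Bool; true; false; _∧_)
open import Data.List using (List; []; _∷_; _++_; map; filter; length; concatMap)
open import Data.List.Relation.Unary.All using (All)
open import Relation.Binary.PropositionalEquality using (_≡_)
open import Relation.Nullary using (Dec; yes; no)
open import Data.Nat using (_≟_)
open import Data.Bool using (T)
open import Relation.Nullary.Decidable using (T?)

-- Steps of a lattice path: U = (1,1), D = (1,-1).
data Step : Set where
  U D : Step

words : ℕ → List (List Step)
words zero    = [] ∷ []
words (suc m) = map (U ∷_) (words m) ++ map (D ∷_) (words m)

#U : List Step → ℕ
#U []      = 0
#U (U ∷ w) = suc (#U w)
#U (D ∷ w) = #U w

#D : List Step → ℕ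
#D []      = 0
#D (U ∷ w) = #D w
#D (D ∷ w) = suc (#D w)

pathOK : ℕ → List Step → Bool
pathOK zero    []      = true
pathOK (suc _) []      = false
pathOK h       (U ∷ w) = pathOK (suc h) w
pathOK zero    (D ∷ w) = false
pathOK (suc h) (D ∷ w) = pathOK h w

IsDyck : ℕ → List Step → Set
IsDyck n w = (#U w ≡ n) Data.Product.× (#D w ≡ n) Data.Product.× T (pathOK 0 w)
  where import Data.Product

isDyck? : ∀ n w → Dec (IsDyck n w)
isDyck? n w with #U w ≟ n | #D w ≟ n | T? (pathOK 0 w)
... | yes a | yes b | yes c = yes (a Data.Product., b Data.Product., c)
  where import Data.Product
... | no ¬a | _ | _ = no λ x → ¬a (Data.Product.proj₁ x)
  where import Data.Product
... | yes _ | no ¬b | _ = no λ x → ¬b (Data.Product.proj₁ (Data.Product.proj₂ x))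
  where import Data.Product
... | yes _ | yes _ | no ¬c = no λ x → ¬c (Data.Product.proj₂ (Data.Product.proj₂ x))
  where import Data.Product

dyckPaths : ℕ → List (List Step)
dyckPaths n = filter (isDyck? n) (words (n + n))

startsUsDU : List Step → Bool
startsUsDU (U ∷ w)     = startsUsDU w
startsUsDU (D ∷ U ∷ _) = true
startsUsDU _           = false

startsDUtDU : List Step → Bool
startsDUtDU (D ∷ U ∷ w) = startsUsDU w
startsDUtDU _           = false

startsDDD : List Step → Bool
startsDDD (D ∷ D ∷ D ∷ _) = true
startsDDD _               = false

occ : (List Step → Bool) → List Step → ℕ
occ p []       = 0
occ p (s ∷ w) with p (s ∷ w)
... | true  = suc (occ p w)
... | false = occ p w

f : List Step → ℕ
f = occ startsDDD

g : List Step → ℕ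
g = occ startsDUtDU

-- Coefficient of x^k in Σ_{P ∈ ps} x^{stat(P)}.
coeff : (List Step → ℕ) → List (List Step) → ℕ → ℕ
coeff stat []       k = 0
coeff stat (P ∷ ps) k with stat P ≟ k
... | yes _ = suc (coeff stat ps k)
... | no  _ = coeff stat ps k

-- Cutting a Dyck path at its first return, U A D B, makes it a binary tree with
-- subtrees for A and B (path is the inverse). No DDD in A D B reaches into B, which
-- starts with U, and no DU^tDU starting inside A leaves A, which ends with D; so
--   f (U A D B) = f (A D) + f B   and   g (U A D B) = g A + g (D B).
-- By induction on trees, f P = g P′ and f (P D) = g (D P′) when P′ comes from the
-- mirror image of the tree of P; and mirroring permutes the trees with n nodes.

module Submission where

open import Defs
open import Data.Nat using (ℕ; zero; suc; _+_; _≟_)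
open import Data.Nat.Properties using (+-comm; +-suc)
open import Data.Bool using (true; false; T)
open import Data.Unit using (tt)
open import Data.Maybe using (just)
open import Data.Empty using (⊥-elim)
open import Data.List using (List; []; _∷_; _++_; map; filter; length; concatMap; head; last)
open import Data.List.Properties
  using (++-assoc; ++-identityʳ; ∷-injectiveˡ; ∷-injectiveʳ; map-∘; map-cong; map-id-local; filter-accept; filter-reject)
open import Data.List.Membership.Propositional using (_∈_)
open import Data.List.Membership.Propositional.Properties
  using (∈-map⁺; ∈-map⁻; ∈-++⁺ˡ; ∈-++⁺ʳ; ∈-filter⁺; ∈-filter⁻)
open import Data.List.Membership.Propositional.Properties.WithK using (unique∧set⇒bag)
open import Data.List.Relation.Unary.Any using (here)
open import Data.List.Relation.Unary.All using ([])
import Data.List.Relation.Unary.All as All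
open import Data.List.Relation.Unary.AllPairs using ([]; _∷_)
open import Data.List.Relation.Unary.Unique.Propositional using (Unique)
import Data.List.Relation.Unary.Unique.Propositional.Properties as Unique
open import Data.List.Relation.Binary.BagAndSetEquality using (∼bag⇒↭)
open import Data.List.Relation.Binary.Permutation.Propositional using (_↭_)
open import Data.List.Relation.Binary.Permutation.Propositional.Properties using (↭-length; filter-↭)
import Data.List.Relation.Binary.Permutation.Propositional.Properties as ↭
open import Data.Product using (_×_; _,_; proj₁; proj₂)
open import Function using (_∘_)
open import Function.Bundles using (mk⇔)
open import Relation.Nullary using (yes; no; ¬_)
open import Relation.Binary.PropositionalEquality
open ≡-Reasoning

occ-∷-+ : ∀ p s {xs ys m} → p (s ∷ xs) ≡ p (s ∷ ys) →
          occ p xs ≡ occ p ys + m → occ p (s ∷ xs) ≡ occ p (s ∷ ys) + m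
occ-∷-+ p s {xs} {ys} _ rest with p (s ∷ xs) | p (s ∷ ys)
occ-∷-+ p s refl rest | true  | true  = cong suc rest
occ-∷-+ p s refl rest | false | false = rest

startsDDD-prefix₃ : ∀ x y z Z Z′ → startsDDD (x ∷ y ∷ z ∷ Z) ≡ startsDDD (x ∷ y ∷ z ∷ Z′)
startsDDD-prefix₃ U y z Z Z′ = refl
startsDDD-prefix₃ D U z Z Z′ = refl
startsDDD-prefix₃ D D U Z Z′ = refl
startsDDD-prefix₃ D D D Z Z′ = refl

startsDDD-prefix₂-++-D∷ : ∀ x y X Z Z′ →
                 startsDDD (x ∷ y ∷ X ++ D ∷ Z) ≡ startsDDD (x ∷ y ∷ X ++ D ∷ Z′)
startsDDD-prefix₂-++-D∷ x y []      = startsDDD-prefix₃ x y D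
startsDDD-prefix₂-++-D∷ x y (z ∷ X) _ _ = startsDDD-prefix₃ x y z _ _

startsDDD-++-D∷ : ∀ X {Y} → head Y ≢ just D → startsDDD (X ++ D ∷ Y) ≡ startsDDD (X ++ D ∷ [])
startsDDD-++-D∷ []              {[]}    _  = refl
startsDDD-++-D∷ []              {U ∷ _} _  = refl
startsDDD-++-D∷ []              {D ∷ _} hY = ⊥-elim (hY refl)
startsDDD-++-D∷ (x ∷ [])        {[]}    _  = refl
startsDDD-++-D∷ (U ∷ [])        {U ∷ _} _  = refl
startsDDD-++-D∷ (D ∷ [])        {U ∷ _} _  = refl
startsDDD-++-D∷ (x ∷ [])        {D ∷ _} hY = ⊥-elim (hY refl)
startsDDD-++-D∷ (x ∷ y ∷ X)     _       = startsDDD-prefix₂-++-D∷ x y X _ _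

f-split : ∀ X {Y} → head Y ≢ just D → f (X ++ D ∷ Y) ≡ f (X ++ D ∷ []) + f Y
f-split []      hY = occ-∷-+ startsDDD D {ys = []} (startsDDD-++-D∷ [] hY) refl
f-split (x ∷ X) hY = occ-∷-+ startsDDD x (startsDDD-++-D∷ (x ∷ X) hY) (f-split X hY)

f-++-DD : ∀ X → last X ≡ just D → f (X ++ D ∷ D ∷ []) ≡ f (X ++ D ∷ []) + 1
f-++-DD (D ∷ [])    _ = refl
f-++-DD (x ∷ y ∷ X) e = occ-∷-+ startsDDD x (startsDDD-prefix₂-++-D∷ x y X _ _) (f-++-DD (y ∷ X) e)

last-tail : ∀ x X → last (x ∷ X) ≢ just U → last X ≢ just U
last-tail x []      _ ()
last-tail x (y ∷ X) h = h

startsUsDU-++-D∷ : ∀ X {Y} → last (U ∷ X) ≢ just U → startsUsDU (X ++ D ∷ Y) ≡ startsUsDU X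
startsUsDU-++-D∷ []          h = ⊥-elim (h refl)
startsUsDU-++-D∷ (U ∷ X)     h = startsUsDU-++-D∷ X h
startsUsDU-++-D∷ (D ∷ [])    _ = refl
startsUsDU-++-D∷ (D ∷ U ∷ X) _ = refl
startsUsDU-++-D∷ (D ∷ D ∷ X) _ = refl

startsDUtDU-++-D∷ : ∀ x X {Y} → last (x ∷ X) ≢ just U →
                    startsDUtDU (x ∷ X ++ D ∷ Y) ≡ startsDUtDU (x ∷ X)
startsDUtDU-++-D∷ U X       _ = refl
startsDUtDU-++-D∷ D []      _ = refl
startsDUtDU-++-D∷ D (D ∷ X) _ = refl
startsDUtDU-++-D∷ D (U ∷ X) h = startsUsDU-++-D∷ X h

g-split : ∀ X Y → last X ≢ just U → g (X ++ D ∷ Y) ≡ g X + g (D ∷ Y)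
g-split []      Y _ = refl
g-split (x ∷ X) Y h = occ-∷-+ startsDUtDU x (startsDUtDU-++-D∷ x X h) (g-split X Y (last-tail x X h))

g-DUU : ∀ Z → g (D ∷ U ∷ U ∷ Z) ≡ g (D ∷ U ∷ Z)
g-DUU Z with startsUsDU Z
... | true  = refl
... | false = refl

last-++ : ∀ {A : Set} (X : List A) {y Y} → last (X ++ y ∷ Y) ≡ last (y ∷ Y)
last-++ []           = refl
last-++ (x ∷ [])     = refl
last-++ (x ∷ x′ ∷ X) = last-++ (x′ ∷ X)

data Tree : Set where
  leaf : Tree
  node : Tree → Tree → Tree

path : Tree → List Step
path leaf       = []
path (node l r) = U ∷ path l ++ D ∷ path r

mirror : Tree → Tree
mirror leaf       = leaf
mirror (node l r) = node (mirror r) (mirror l)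

head-path : ∀ t → head (path t) ≢ just D
head-path leaf       ()
head-path (node l r) ()

last-D∷path : ∀ t → last (D ∷ path t) ≡ just D
last-D∷path leaf       = refl
last-D∷path (node l r) = trans (last-++ (U ∷ path l)) (last-D∷path r)

last-path : ∀ t → last (path t) ≢ just U
last-path leaf       ()
last-path (node l r) e with () ← trans (sym (last-D∷path (node l r))) e

f-path-D≡g-D-path-mirror : ∀ t → f (path t ++ D ∷ []) ≡ g (D ∷ path (mirror t))
f-path-D≡g-D-path-mirror leaf = refl
f-path-D≡g-D-path-mirror (node leaf leaf) = refl
-- Here the final D of path l D D and the initial D U D U of the mirror each add an occurrence.
f-path-D≡g-D-path-mirror (node l@(node _ _) leaf) = begin
  f (U ∷ (path l ++ D ∷ []) ++ D ∷ [])   ≡⟨ cong (λ xs → f (U ∷ xs)) (++-assoc (path l) (D ∷ []) (D ∷ [])) ⟩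
  f (path l ++ D ∷ D ∷ [])               ≡⟨ f-++-DD (path l) (last-D∷path l) ⟩
  f (path l ++ D ∷ []) + 1               ≡⟨ cong (_+ 1) (f-path-D≡g-D-path-mirror l) ⟩
  g (D ∷ path (mirror l)) + 1            ≡⟨ +-comm _ 1 ⟩
  g (D ∷ U ∷ D ∷ path (mirror l))        ∎
f-path-D≡g-D-path-mirror (node l r@(node a b)) = begin
  f (U ∷ (path l ++ D ∷ path r) ++ D ∷ [])     ≡⟨ cong (λ xs → f (U ∷ xs)) (++-assoc (path l) (D ∷ path r) (D ∷ [])) ⟩
  f (path l ++ D ∷ (path r ++ D ∷ []))         ≡⟨ f-split (path l) (λ ()) ⟩
  f (path l ++ D ∷ []) + f (path r ++ D ∷ [])  ≡⟨ cong₂ _+_ (f-path-D≡g-D-path-mirror l) (f-path-D≡g-D-path-mirror r) ⟩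
  g (D ∷ path (mirror l)) + g (D ∷ path (mirror r)) ≡⟨ +-comm (g (D ∷ path (mirror l))) _ ⟩
  g (D ∷ path (mirror r)) + g (D ∷ path (mirror l)) ≡⟨ cong (_+ _) (sym (g-DUU (path (mirror b) ++ D ∷ path (mirror a)))) ⟩
  g (D ∷ U ∷ path (mirror r)) + g (D ∷ path (mirror l)) ≡⟨ sym (g-split (D ∷ U ∷ path (mirror r)) _ (last-path (mirror r))) ⟩
  g (D ∷ path (mirror (node l r)))             ∎

f-path≡g-path-mirror : ∀ t → f (path t) ≡ g (path (mirror t))
f-path≡g-path-mirror leaf       = refl
f-path≡g-path-mirror (node l r) = begin
  f (path l ++ D ∷ path r)                    ≡⟨ f-split (path l) (head-path r) ⟩
  f (path l ++ D ∷ []) + f (path r)           ≡⟨ cong₂ _+_ (f-path-D≡g-D-path-mirror l) (f-path≡g-path-mirror r) ⟩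
  g (D ∷ path (mirror l)) + g (path (mirror r)) ≡⟨ +-comm (g (D ∷ path (mirror l))) _ ⟩
  g (path (mirror r)) + g (D ∷ path (mirror l)) ≡⟨ sym (g-split (path (mirror r)) _ (last-path (mirror r))) ⟩
  g (path (mirror (node l r)))                ∎

size : Tree → ℕ
size leaf       = 0
size (node l r) = suc (size l + size r)

mirror-involutive : ∀ t → mirror (mirror t) ≡ t
mirror-involutive leaf       = refl
mirror-involutive (node l r) = cong₂ node (mirror-involutive l) (mirror-involutive r)

size-mirror : ∀ t → size (mirror t) ≡ size t
size-mirror leaf       = refl
size-mirror (node l r) = cong suc (trans (cong₂ _+_ (size-mirror r) (size-mirror l)) (+-comm (size r) (size l)))

#U-++ : ∀ X Y → #U (X ++ Y) ≡ #U X + #U Y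
#U-++ []      Y = refl
#U-++ (U ∷ X) Y = cong suc (#U-++ X Y)
#U-++ (D ∷ X) Y = #U-++ X Y

#D-++ : ∀ X Y → #D (X ++ Y) ≡ #D X + #D Y
#D-++ []      Y = refl
#D-++ (U ∷ X) Y = #D-++ X Y
#D-++ (D ∷ X) Y = cong suc (#D-++ X Y)

#U-path : ∀ t → #U (path t) ≡ size t
#U-path leaf       = refl
#U-path (node l r) = cong suc (trans (#U-++ (path l) (D ∷ path r)) (cong₂ _+_ (#U-path l) (#U-path r)))

#D-path : ∀ t → #D (path t) ≡ size t
#D-path leaf       = refl
#D-path (node l r) = begin
  #D (path l ++ D ∷ path r)        ≡⟨ #D-++ (path l) (D ∷ path r) ⟩
  #D (path l) + suc (#D (path r))  ≡⟨ cong₂ (λ a b → a + suc b) (#D-path l) (#D-path r) ⟩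
  size l + suc (size r)            ≡⟨ +-suc (size l) (size r) ⟩
  suc (size l + size r)            ∎

pathOK-U : ∀ h X → pathOK h (U ∷ X) ≡ pathOK (suc h) X
pathOK-U zero    X = refl
pathOK-U (suc h) X = refl

pathOK-path-++ : ∀ h t Z → pathOK h (path t ++ Z) ≡ pathOK h Z
pathOK-path-++ h leaf       Z = refl
pathOK-path-++ h (node l r) Z = begin
  pathOK h (U ∷ (path l ++ D ∷ path r) ++ Z)  ≡⟨ pathOK-U h _ ⟩
  pathOK (suc h) ((path l ++ D ∷ path r) ++ Z) ≡⟨ cong (pathOK (suc h)) (++-assoc (path l) (D ∷ path r) Z) ⟩
  pathOK (suc h) (path l ++ D ∷ (path r ++ Z)) ≡⟨ pathOK-path-++ (suc h) l (D ∷ path r ++ Z) ⟩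
  pathOK h (path r ++ Z)                       ≡⟨ pathOK-path-++ h r Z ⟩
  pathOK h Z                                   ∎

path-isDyck : ∀ t → IsDyck (size t) (path t)
path-isDyck t = #U-path t , #D-path t , path-ok
  where
  path-ok : T (pathOK 0 (path t))
  path-ok = subst (T ∘ pathOK 0) (++-identityʳ (path t)) (subst T (sym (pathOK-path-++ 0 t [])) tt)

-- (t , s₁ ∷ … ∷ sₕ) stands for the word path t D path s₁ … D path sₕ (see unparse);
-- parseStack builds it from the right end of a word.
Stack : Set
Stack = Tree × List Tree

push : Tree → Stack → Stack
push t (s , ss) = t , s ∷ ss

join : Stack → Stack
join (t , [])     = t , []    -- unreachable on Dyck words
join (t , s ∷ ss) = node t s , ss

parseStack : List Step → Stack
parseStack []      = leaf , []
parseStack (U ∷ X) = join (parseStack X)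
parseStack (D ∷ X) = push leaf (parseStack X)

unparse : Stack → List Step
unparse (t , ss) = path t ++ concatMap (λ s → D ∷ path s) ss

parse : List Step → Tree
parse = proj₁ ∘ parseStack

parseStack-path-D∷ : ∀ t Z → parseStack (path t ++ D ∷ Z) ≡ push t (parseStack Z)
parseStack-path-D∷ leaf       Z = refl
parseStack-path-D∷ (node l r) Z = begin
  join (parseStack ((path l ++ D ∷ path r) ++ D ∷ Z))  ≡⟨ cong (join ∘ parseStack) (++-assoc (path l) (D ∷ path r) (D ∷ Z)) ⟩
  join (parseStack (path l ++ D ∷ (path r ++ D ∷ Z)))  ≡⟨ cong join (parseStack-path-D∷ l (path r ++ D ∷ Z)) ⟩
  join (push l (parseStack (path r ++ D ∷ Z)))         ≡⟨ cong (join ∘ push l) (parseStack-path-D∷ r Z) ⟩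
  join (push l (push r (parseStack Z)))                ∎

parse-path : ∀ t → parse (path t) ≡ t
parse-path leaf       = refl
parse-path (node l r) = begin
  proj₁ (join (parseStack (path l ++ D ∷ path r)))  ≡⟨ cong (proj₁ ∘ join) (parseStack-path-D∷ l (path r)) ⟩
  node l (parse (path r))                           ≡⟨ cong (node l) (parse-path r) ⟩
  node l r                                          ∎

join-sound : ∀ h X p → length (proj₂ p) ≡ suc h → unparse p ≡ X →
             length (proj₂ (join p)) ≡ h × unparse (join p) ≡ U ∷ X
join-sound h X (t , s ∷ ss) refl e = refl , cong (U ∷_) (trans (++-assoc (path t) (D ∷ path s) _) e)

parseStack-sound : ∀ h X → T (pathOK h X) →
                   length (proj₂ (parseStack X)) ≡ h × unparse (parseStack X) ≡ X
parseStack-sound zero    []      _  = refl , refl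
parseStack-sound h       (U ∷ X) ok with parseStack-sound (suc h) X (subst T (pathOK-U h X) ok)
... | height , e = join-sound h X (parseStack X) height e
parseStack-sound (suc h) (D ∷ X) ok with parseStack-sound h X ok
... | height , e = cong suc height , cong (D ∷_) e

path-parse : ∀ X → T (pathOK 0 X) → path (parse X) ≡ X
path-parse X ok with parseStack X | parseStack-sound 0 X ok
... | t , [] | _ , e = trans (sym (++-identityʳ (path t))) e

length≡#U+#D : ∀ X → length X ≡ #U X + #D X
length≡#U+#D []      = refl
length≡#U+#D (U ∷ X) = cong suc (length≡#U+#D X)
length≡#U+#D (D ∷ X) = trans (cong suc (length≡#U+#D X)) (sym (+-suc (#U X) (#D X)))

∈-words : ∀ X → X ∈ words (length X)
∈-words []      = here refl
∈-words (U ∷ X) = ∈-++⁺ˡ (∈-map⁺ (U ∷_) (∈-words X))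
∈-words (D ∷ X) = ∈-++⁺ʳ (map (U ∷_) (words (length X))) (∈-map⁺ (D ∷_) (∈-words X))

words-unique : ∀ m → Unique (words m)
words-unique zero    = [] ∷ []
words-unique (suc m) = Unique.++⁺ (Unique.map⁺ ∷-injectiveʳ (words-unique m))
                                  (Unique.map⁺ ∷-injectiveʳ (words-unique m)) disjoint
  where
  disjoint : ∀ {X} → ¬ (X ∈ map (U ∷_) (words m) × X ∈ map (D ∷_) (words m))
  disjoint (p , q) with ∈-map⁻ (U ∷_) p | ∈-map⁻ (D ∷_) q
  ... | _ , _ , refl | _ , _ , e with () ← ∷-injectiveˡ e

dyckPaths-unique : ∀ n → Unique (dyckPaths n)
dyckPaths-unique n = Unique.filter⁺ (isDyck? n) (words-unique (n + n))

∈-dyckPaths⁺ : ∀ {n X} → IsDyck n X → X ∈ dyckPaths n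
∈-dyckPaths⁺ {n} {X} dyck@(#U≡n , #D≡n , _) =
  ∈-filter⁺ (isDyck? n) (subst (λ m → X ∈ words m) (trans (length≡#U+#D X) (cong₂ _+_ #U≡n #D≡n)) (∈-words X)) dyck

∈-dyckPaths⁻ : ∀ n {X} → X ∈ dyckPaths n → IsDyck n X
∈-dyckPaths⁻ n = proj₂ ∘ ∈-filter⁻ (isDyck? n) {xs = words (n + n)}

involution-map-↭ : ∀ {A : Set} {h : A → A} {xs : List A} → (∀ x → h (h x) ≡ x) →
                   Unique xs → (∀ {x} → x ∈ xs → h x ∈ xs) → map h xs ↭ xs
involution-map-↭ {h = h} {xs} involutive unique closed =
  ∼bag⇒↭ (unique∧set⇒bag (Unique.map⁺ injective unique) unique (mk⇔ to from))
  where
  injective : ∀ {x y} → h x ≡ h y → x ≡ y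
  injective {x} {y} e = trans (sym (involutive x)) (trans (cong h e) (involutive y))
  to : ∀ {x} → x ∈ map h xs → x ∈ xs
  to m with ∈-map⁻ h m
  ... | _ , m′ , refl = closed m′
  from : ∀ {x} → x ∈ xs → x ∈ map h xs
  from {x} m = subst (_∈ map h xs) (involutive x) (∈-map⁺ h (closed m))

coeff≡length-filter : ∀ s xs k → coeff s xs k ≡ length (filter (_≟ k) (map s xs))
coeff≡length-filter s []       k = refl
coeff≡length-filter s (x ∷ xs) k with s x ≟ k
... | yes sx≡k = trans (cong suc (coeff≡length-filter s xs k)) (sym (cong length (filter-accept (_≟ k) sx≡k)))
... | no  sx≢k = trans (coeff≡length-filter s xs k) (sym (cong length (filter-reject (_≟ k) sx≢k)))

coeff-↭ : ∀ {s s′ xs ys} → map s xs ↭ map s′ ys → ∀ k → coeff s xs k ≡ coeff s′ ys k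
coeff-↭ {s} {s′} {xs} {ys} p k = begin
  coeff s xs k                             ≡⟨ coeff≡length-filter s xs k ⟩
  length (filter (_≟ k) (map s xs))        ≡⟨ ↭-length (filter-↭ (_≟ k) p) ⟩
  length (filter (_≟ k) (map s′ ys))       ≡⟨ coeff≡length-filter s′ ys k ⟨
  coeff s′ ys k                            ∎

module _ (n : ℕ) where

  trees : List Tree
  trees = map parse (dyckPaths n)

  path-trees : map path trees ≡ dyckPaths n
  path-trees = trans (sym (map-∘ (dyckPaths n)))
    (map-id-local (All.tabulate λ m → path-parse _ (proj₂ (proj₂ (∈-dyckPaths⁻ n m)))))

  trees-unique : Unique trees
  trees-unique = Unique.map⁻ (subst Unique (sym path-trees) (dyckPaths-unique n))

  ∈-trees⁻ : ∀ {t} → t ∈ trees → size t ≡ n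
  ∈-trees⁻ m with ∈-map⁻ parse m
  ... | X , X∈ , refl = begin
    size (parse X)         ≡⟨ #U-path (parse X) ⟨
    #U (path (parse X))    ≡⟨ cong #U (path-parse X (proj₂ (proj₂ (∈-dyckPaths⁻ n X∈)))) ⟩
    #U X                   ≡⟨ proj₁ (∈-dyckPaths⁻ n X∈) ⟩
    n                      ∎

  ∈-trees⁺ : ∀ {t} → size t ≡ n → t ∈ trees
  ∈-trees⁺ {t} refl = subst (_∈ trees) (parse-path t) (∈-map⁺ parse {x = path t} (∈-dyckPaths⁺ (path-isDyck t)))

  mirror-permutes-trees : map mirror trees ↭ trees
  mirror-permutes-trees = involution-map-↭ mirror-involutive trees-unique
    (λ m → ∈-trees⁺ (trans (size-mirror _) (∈-trees⁻ m)))

  equidistributed : map f (dyckPaths n) ↭ map g (dyckPaths n)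
  equidistributed = subst₂ _↭_ f-values g-values (↭.map⁺ (g ∘ path) mirror-permutes-trees)
    where
    f-values : map (g ∘ path) (map mirror trees) ≡ map f (dyckPaths n)
    f-values = begin
      map (g ∘ path) (map mirror trees) ≡⟨ map-∘ trees ⟨
      map (g ∘ path ∘ mirror) trees     ≡⟨ map-cong f-path≡g-path-mirror trees ⟨
      map (f ∘ path) trees              ≡⟨ map-∘ trees ⟩
      map f (map path trees)            ≡⟨ cong (map f) path-trees ⟩
      map f (dyckPaths n)               ∎
    g-values : map (g ∘ path) trees ≡ map g (dyckPaths n)
    g-values = trans (map-∘ trees) (cong (map g) path-trees)

proposition7 : (n k : ℕ) → coeff f (dyckPaths n) k ≡ coeff g (dyckPaths n) k
proposition7 n = coeff-↭ (equidistributed n)
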